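{- There exist an absolute constant $c>0$ and strings $T$ (over a three-letter alphabet) with arbitrarily large run-length encoding size $m=R(T)$ such that $|\mathcal{M}_4(T)|\ge c\,m^2$; i.e. there exist strings $T$ with $R(T)=m$ and $|\mathcal{M}_4(T)|\in\Omega(m^2)$.
   Context: Here $T$ is a plain string over an alphabet $\Sigma$ (no terminal symbols). For a string $w$, $R(w)$ is the number of maximal runs of equal characters in $w$. A string $w\in\Sigma^*$ is a minimal absent word (MAW) for $T$ if $w$ does not occur in $T$ but every proper substring of $w$ occurs in $T$. Writing a MAW of length $\ge2$ as $aub$ ($a,b\in\Sigma$, $u\in\Sigma^*$), $\mathcal{M}_4(T)$ is the set of MAWs with $R(aub)\ge4$, $a\neq u[1]$ and $b\neq u[|u|]$. -}

module Defs where

open import Data.Nat using (ℕ; zero; suc; _+_; _<_)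
open import Data.Fin using (Fin)
open import Data.List using (List; []; _∷_; _++_; length)
open import Data.Product using (∃; ∃-syntax; _×_; _,_)
open import Relation.Binary.PropositionalEquality using (_≡_; _≢_)
open import Relation.Nullary using (¬_; Dec; yes; no)

Occurs : {Σ : Set} → List Σ → List Σ → Set
Occurs {Σ} v T = ∃[ xs ] ∃[ ys ] (T ≡ xs ++ v ++ ys)

ProperSubstring : {Σ : Set} → List Σ → List Σ → Set
ProperSubstring v w = Occurs v w × length v < length w

MAW : {Σ : Set} → List Σ → List Σ → Set
MAW {Σ} T w = ¬ Occurs w T × (∀ (v : List Σ) → ProperSubstring v w → Occurs v T)

module Runs {Σ : Set} (_≟_ : (x y : Σ) → Dec (x ≡ y)) where

  runsFrom : Σ → List Σ → ℕ
  runsFrom x [] = 1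
  runsFrom x (y ∷ ys) with x ≟ y
  ... | yes _ = runsFrom y ys
  ... | no  _ = suc (runsFrom y ys)

  R : List Σ → ℕ
  R [] = 0
  R (x ∷ xs) = runsFrom x xs

  -- w ∈ 𝓜₄(T): w = a u b is a MAW with R(aub) ≥ 4, a ≠ u[1], b ≠ u[|u|]
  -- (u is required nonempty so that u[1], u[|u|] exist; |u| = 0 gives R ≤ 2 anyway)
  InM4 : List Σ → List Σ → Set
  InM4 T w =
    MAW T w ×
    4 Data.Nat.≤ R w ×
    ∃[ a ] ∃[ u ] ∃[ b ]
      ( w ≡ a ∷ (u ++ b ∷ [])
      × ∃[ u₁ ] ∃[ u' ] (u ≡ u₁ ∷ u')
      × (∀ x (v : List Σ) → u ≡ x ∷ v → a ≢ x)
      × (∀ y (v : List Σ) → u ≡ v ++ y ∷ [] → b ≢ y))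

module Submission where

open import Defs
open import Data.Nat using (ℕ; _*_; _≤_; _<_; _^_)
open import Data.Fin using (Fin)
open import Data.Fin.Properties using (_≟_)
open import Data.List using (List; length)
open import Data.List.Relation.Unary.All using (All)
open import Data.List.Relation.Unary.Unique.Propositional using (Unique)
open import Data.Product using (∃-syntax; _×_)
open Defs.Runs {Fin 3} _≟_ using (R; InM4)

open import Data.Nat using (zero; suc; _+_; _∸_; s≤s; z≤n; s≤s⁻¹)
open import Data.Nat.Properties
  using (<-irrefl; m+[n∸m]≡n; m∸n+n≡m; n≤1+n; m≤m+n; m≤n*m; ≤-reflexive; *-identityˡ; *-identityʳ; +-monoʳ-≤; *-mono-≤; +-assoc; module ≤-Reasoning)
open import Data.Nat.Tactic.RingSolver using (solve-∀)
open import Data.Fin using (zero; suc)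
open import Data.List
  using ([]; _∷_; _++_; replicate; foldl; concatMap; upTo; cartesianProductWith; map; initLast; _∷ʳ′_)
open import Data.List.Properties
  using (++-assoc; ++-identityʳ; ∷-injectiveʳ; ∷ʳ-injectiveˡ; foldl-++; length-++; length-map; length-upTo; length-replicate)
open import Data.List.Membership.Propositional using (_∈_)
open import Data.List.Membership.Propositional.Properties using (∈-cartesianProductWith⁻; ∈-upTo⁺; ∈-upTo⁻)
open import Data.List.Relation.Unary.Any using (here; there)
import Data.List.Relation.Unary.All as All
open import Data.List.Relation.Unary.All.Properties using (++⁺; ++⁻ʳ; replicate⁺)
open import Data.List.Relation.Unary.Unique.Propositional.Properties using (cartesianProductWith⁺; upTo⁺)
open import Data.Product using (_,_)
open import Data.Empty using (⊥-elim)
open import Relation.Nullary using (¬_; yes; no)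
open import Relation.Binary.Definitions using (DecidableEquality)
open import Relation.Binary.PropositionalEquality
  using (_≡_; _≢_; refl; sym; trans; cong; cong₂; subst; module ≡-Reasoning)

-- For every a, b ≤ k the word 2 (core a b) 2 is a MAW
-- with four runs of the text
--   T_k = 1 · ∏_{a ≤ k} 2 (core a k) 1 · ∏_{b ≤ k} 0 (core k b) 2 :
-- the prefix 2 (core a b) is a prefix of the a-th block of the first product and the suffix
-- (core a b) 2 a suffix of the b-th block of the second, while no factor of T_k has the shape
-- 2 1⁺ 0⁺ 2, which a five-state automaton certifies.  This gives (k+1)² words for 8(k+1)+1 runs.

module _ {Σ : Set} where

  occurs-trans : {u v w : List Σ} → Occurs u v → Occurs v w → Occurs u w
  occurs-trans {u} (as , bs , refl) (xs , ys , refl) = xs ++ as , bs ++ ys , reassoc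
    where
    open ≡-Reasoning
    reassoc : xs ++ (as ++ u ++ bs) ++ ys ≡ (xs ++ as) ++ u ++ bs ++ ys
    reassoc = begin
      xs ++ (as ++ u ++ bs) ++ ys   ≡⟨ cong (xs ++_) (++-assoc as (u ++ bs) ys) ⟩
      xs ++ as ++ (u ++ bs) ++ ys   ≡⟨ cong (λ zs → xs ++ as ++ zs) (++-assoc u bs ys) ⟩
      xs ++ as ++ u ++ bs ++ ys     ≡⟨ ++-assoc xs as (u ++ bs ++ ys) ⟨
      (xs ++ as) ++ u ++ bs ++ ys   ∎

  occurs-++ˡ : {v xs : List Σ} (ys : List Σ) → Occurs v xs → Occurs v (xs ++ ys)
  occurs-++ˡ ys o = occurs-trans o ([] , ys , refl)

  occurs-++ʳ : {v ys : List Σ} (xs : List Σ) → Occurs v ys → Occurs v (xs ++ ys)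
  occurs-++ʳ {ys = ys} xs o = occurs-trans o (xs , [] , cong (xs ++_) (sym (++-identityʳ ys)))

  occurs-concatMap : {A : Set} (f : A → List Σ) {x : A} {xs : List A} →
                     x ∈ xs → Occurs (f x) (concatMap f xs)
  occurs-concatMap f {xs = x ∷ xs} (here refl) = [] , concatMap f xs , refl
  occurs-concatMap f {xs = y ∷ xs} (there x∈xs) = occurs-++ʳ (f y) (occurs-concatMap f x∈xs)

  -- A proper factor of x u y either avoids the first letter, hence lies in u y, or is a
  -- proper prefix, hence lies in x u.
  maw-from-ends : (T : List Σ) (x : Σ) (u : List Σ) (y : Σ) →
                  ¬ Occurs (x ∷ u ++ y ∷ []) T → Occurs (x ∷ u) T → Occurs (u ++ y ∷ []) T →
                  MAW T (x ∷ u ++ y ∷ [])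
  maw-from-ends T x u y absent xu∈T uy∈T = absent , proper-factors
    where
    proper-factors : ∀ v → ProperSubstring v (x ∷ u ++ y ∷ []) → Occurs v T
    proper-factors v ((_ ∷ xs , ys , eq) , _) = occurs-trans (xs , ys , ∷-injectiveʳ eq) uy∈T
    proper-factors v (([] , ys , eq) , shorter) with initLast ys
    ... | [] = ⊥-elim (<-irrefl (cong length (sym (trans eq (++-identityʳ v)))) shorter)
    ... | zs ∷ʳ′ z = occurs-trans ([] , zs , sym (∷ʳ-injectiveˡ (v ++ zs) (x ∷ u) prefix)) xu∈T
      where
      prefix : (v ++ zs) ++ z ∷ [] ≡ (x ∷ u) ++ y ∷ []
      prefix = trans (++-assoc v zs (z ∷ [])) (sym eq)

  replicate-+ : ∀ m n (x : Σ) → replicate (m + n) x ≡ replicate m x ++ replicate n x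
  replicate-+ zero    n x = refl
  replicate-+ (suc m) n x = cong (x ∷_) (replicate-+ m n x)

  replicate-split : ∀ {m n} (x : Σ) → m ≤ n → replicate n x ≡ replicate m x ++ replicate (n ∸ m) x
  replicate-split {m} {n} x m≤n =
    trans (cong (λ i → replicate i x) (sym (m+[n∸m]≡n m≤n))) (replicate-+ m (n ∸ m) x)

  replicate-split′ : ∀ {m n} (x : Σ) → m ≤ n → replicate n x ≡ replicate (n ∸ m) x ++ replicate m x
  replicate-split′ {m} {n} x m≤n =
    trans (cong (λ i → replicate i x) (sym (m∸n+n≡m m≤n))) (replicate-+ (n ∸ m) m x)

  replicate-++-injective : ∀ {x y : Σ} m n {X Y : List Σ} → x ≢ y →
                           replicate m x ++ y ∷ X ≡ replicate n x ++ y ∷ Y → m ≡ n × X ≡ Y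
  replicate-++-injective zero    zero    x≢y eq = refl , ∷-injectiveʳ eq
  replicate-++-injective zero    (suc n) x≢y refl = ⊥-elim (x≢y refl)
  replicate-++-injective (suc m) zero    x≢y refl = ⊥-elim (x≢y refl)
  replicate-++-injective (suc m) (suc n) x≢y eq with replicate-++-injective m n x≢y (∷-injectiveʳ eq)
  ... | m≡n , X≡Y = cong suc m≡n , X≡Y

  module _ (_≟Σ_ : DecidableEquality Σ) where
    open Runs _≟Σ_ using (runsFrom)

    runsFrom-replicate : ∀ x n (r : List Σ) → runsFrom x (replicate n x ++ r) ≡ runsFrom x r
    runsFrom-replicate x zero    r = refl
    runsFrom-replicate x (suc n) r with x ≟Σ x
    ... | yes _  = runsFrom-replicate x n r
    ... | no x≢x = ⊥-elim (x≢x refl)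

module _ {A B : Set} (f : B → A → B) where

  foldl-replicate-fixed : ∀ s x n → f s x ≡ s → foldl f s (replicate n x) ≡ s
  foldl-replicate-fixed s x zero    fix = refl
  foldl-replicate-fixed s x (suc n) fix rewrite fix = foldl-replicate-fixed s x n fix

  foldl-concatMap-invariant : {C : Set} (P : B → Set) (g : C → List A) →
                              (∀ {s} c → P s → P (foldl f s (g c))) →
                              ∀ {s} cs → P s → P (foldl f s (concatMap g cs))
  foldl-concatMap-invariant P g pres []       Ps = Ps
  foldl-concatMap-invariant P g pres {s} (c ∷ cs) Ps
    rewrite foldl-++ f s (g c) (concatMap g cs) =
    foldl-concatMap-invariant P g pres cs (pres c Ps)

length-cartesianProductWith : {A B C : Set} (f : A → B → C) (xs : List A) (ys : List B) →
                              length (cartesianProductWith f xs ys) ≡ length xs * length ys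
length-cartesianProductWith f []       ys = refl
length-cartesianProductWith f (x ∷ xs) ys =
  trans (length-++ (map (f x) ys))
        (cong₂ _+_ (length-map (f x) ys) (length-cartesianProductWith f xs ys))

open Defs.Runs {Fin 3} _≟_ using (runsFrom)

Str : Set
Str = List (Fin 3)

pattern c0 = zero
pattern c1 = suc zero
pattern c2 = suc (suc zero)


core : ℕ → ℕ → Str
core a b = replicate (suc a) c1 ++ replicate (suc b) c0

word : ℕ → ℕ → Str
word a b = c2 ∷ core a b ++ c2 ∷ []

prefixBlock : ℕ → ℕ → Str
prefixBlock k a = c2 ∷ core a k ++ c1 ∷ []

suffixBlock : ℕ → ℕ → Str
suffixBlock k b = c0 ∷ core k b ++ c2 ∷ []

text : ℕ → Str
text k = c1 ∷ concatMap (prefixBlock k) (upTo (suc k)) ++ concatMap (suffixBlock k) (upTo (suc k))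

-- The state is the longest suffix of the input read so far that is a proper prefix of some
-- 2 1⁺ 0⁺ 2 (none if there is none); found is absorbing and means such a factor was read.
data Progress : Set where
  none after2 after21 after210 found : Progress

step : Progress → Fin 3 → Progress
step found    _  = found
step after210 c2 = found
step _        c2 = after2
step after2   c1 = after21
step after21  c1 = after21
step after21  c0 = after210
step after210 c0 = after210
step _        _  = none

steps : Progress → Str → Progress
steps = foldl step

steps-found : ∀ xs → steps found xs ≡ found
steps-found []       = refl
steps-found (_ ∷ xs) = steps-found xs

steps-core : ∀ a b → steps after2 (core a b) ≡ after210
steps-core a b = begin
  steps after21 (replicate a c1 ++ c0 ∷ replicate b c0)    ≡⟨ foldl-++ step after21 (replicate a c1) _ ⟩
  steps (steps after21 (replicate a c1)) (c0 ∷ replicate b c0)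
    ≡⟨ cong (λ t → steps t (c0 ∷ replicate b c0)) (foldl-replicate-fixed step after21 c1 a refl) ⟩
  steps after210 (replicate b c0)                          ≡⟨ foldl-replicate-fixed step after210 c0 b refl ⟩
  after210                                                 ∎
  where open ≡-Reasoning

steps-none-core : ∀ a b → steps none (core a b) ≡ none
steps-none-core a b = begin
  steps none (replicate (suc a) c1 ++ replicate (suc b) c0)
    ≡⟨ foldl-++ step none (replicate (suc a) c1) (replicate (suc b) c0) ⟩
  steps (steps none (replicate (suc a) c1)) (replicate (suc b) c0)
    ≡⟨ cong (λ t → steps t (replicate (suc b) c0)) (foldl-replicate-fixed step none c1 (suc a) refl) ⟩
  steps none (replicate (suc b) c0)                        ≡⟨ foldl-replicate-fixed step none c0 (suc b) refl ⟩
  none                                                     ∎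
  where open ≡-Reasoning

steps-after2-completes : ∀ a b → steps after2 (core a b ++ c2 ∷ []) ≡ found
steps-after2-completes a b =
  trans (foldl-++ step after2 (core a b) (c2 ∷ [])) (cong (λ t → step t c2) (steps-core a b))

steps-word : ∀ s a b → steps s (word a b) ≡ found
steps-word found    a b = steps-found (core a b ++ c2 ∷ [])
steps-word after210 a b = steps-found (core a b ++ c2 ∷ [])
steps-word none     a b = steps-after2-completes a b
steps-word after2   a b = steps-after2-completes a b
steps-word after21  a b = steps-after2-completes a b

steps-prefixBlock : ∀ k a → steps none (prefixBlock k a) ≡ none
steps-prefixBlock k a =
  trans (foldl-++ step after2 (core a k) (c1 ∷ [])) (cong (λ t → step t c1) (steps-core a k))

ResetBy0 : Progress → Set
ResetBy0 s = step s c0 ≡ none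

steps-suffixBlock : ∀ k b {s} → ResetBy0 s → ResetBy0 (steps s (suffixBlock k b))
steps-suffixBlock k b reset rewrite reset
                                  | foldl-++ step none (core k b) (c2 ∷ [])
                                  | steps-none-core k b = refl

steps-text : ∀ k → ResetBy0 (steps none (text k))
steps-text k rewrite foldl-++ step none (concatMap (prefixBlock k) (upTo (suc k)))
                                       (concatMap (suffixBlock k) (upTo (suc k))) =
  foldl-concatMap-invariant step ResetBy0 (suffixBlock k) (λ b → steps-suffixBlock k b) (upTo (suc k))
    (subst ResetBy0 (sym prefixes-none) refl)
  where
  prefixes-none : steps none (concatMap (prefixBlock k) (upTo (suc k))) ≡ none
  prefixes-none = foldl-concatMap-invariant step (_≡ none) (prefixBlock k)
    (λ { a refl → steps-prefixBlock k a }) (upTo (suc k)) refl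

word-absent : ∀ k a b → ¬ Occurs (word a b) (text k)
word-absent k a b (xs , ys , eq) with subst ResetBy0 trapped (steps-text k)
  where
  open ≡-Reasoning
  trapped : steps none (text k) ≡ found
  trapped = begin
    steps none (text k)                                  ≡⟨ cong (steps none) eq ⟩
    steps none (xs ++ word a b ++ ys)                    ≡⟨ foldl-++ step none xs (word a b ++ ys) ⟩
    steps (steps none xs) (word a b ++ ys)               ≡⟨ foldl-++ step (steps none xs) (word a b) ys ⟩
    steps (steps (steps none xs) (word a b)) ys          ≡⟨ cong (λ t → steps t ys) (steps-word _ a b) ⟩
    steps found ys                                       ≡⟨ steps-found ys ⟩
    found                                                ∎
... | ()

core-extendʳ : ∀ a {b k} → b ≤ k → core a k ≡ core a b ++ replicate (k ∸ b) c0
core-extendʳ a {b} {k} b≤k = begin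
  replicate (suc a) c1 ++ replicate (suc k) c0
    ≡⟨ cong (replicate (suc a) c1 ++_) (replicate-split c0 (s≤s b≤k)) ⟩
  replicate (suc a) c1 ++ replicate (suc b) c0 ++ replicate (k ∸ b) c0
    ≡⟨ ++-assoc (replicate (suc a) c1) (replicate (suc b) c0) (replicate (k ∸ b) c0) ⟨
  core a b ++ replicate (k ∸ b) c0 ∎
  where open ≡-Reasoning

core-extendˡ : ∀ {a k} b → a ≤ k → core k b ≡ replicate (k ∸ a) c1 ++ core a b
core-extendˡ {a} {k} b a≤k = begin
  replicate (suc k) c1 ++ replicate (suc b) c0
    ≡⟨ cong (_++ replicate (suc b) c0) (replicate-split′ c1 (s≤s a≤k)) ⟩
  (replicate (k ∸ a) c1 ++ replicate (suc a) c1) ++ replicate (suc b) c0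
    ≡⟨ ++-assoc (replicate (k ∸ a) c1) (replicate (suc a) c1) (replicate (suc b) c0) ⟩
  replicate (k ∸ a) c1 ++ core a b ∎
  where open ≡-Reasoning

prefix-in-prefixBlock : ∀ a {b k} → b ≤ k → Occurs (c2 ∷ core a b) (prefixBlock k a)
prefix-in-prefixBlock a {b} {k} b≤k = [] , replicate (k ∸ b) c0 ++ c1 ∷ [] , cong (c2 ∷_) (begin
  core a k ++ c1 ∷ []                               ≡⟨ cong (_++ c1 ∷ []) (core-extendʳ a b≤k) ⟩
  (core a b ++ replicate (k ∸ b) c0) ++ c1 ∷ []     ≡⟨ ++-assoc (core a b) (replicate (k ∸ b) c0) (c1 ∷ []) ⟩
  core a b ++ replicate (k ∸ b) c0 ++ c1 ∷ []       ∎)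
  where open ≡-Reasoning

suffix-in-suffixBlock : ∀ {a k} b → a ≤ k → Occurs (core a b ++ c2 ∷ []) (suffixBlock k b)
suffix-in-suffixBlock {a} {k} b a≤k = c0 ∷ replicate (k ∸ a) c1 , [] , cong (c0 ∷_) (begin
  core k b ++ c2 ∷ []                               ≡⟨ cong (_++ c2 ∷ []) (core-extendˡ b a≤k) ⟩
  (replicate (k ∸ a) c1 ++ core a b) ++ c2 ∷ []     ≡⟨ ++-assoc (replicate (k ∸ a) c1) (core a b) (c2 ∷ []) ⟩
  replicate (k ∸ a) c1 ++ core a b ++ c2 ∷ []       ≡⟨ cong (replicate (k ∸ a) c1 ++_) (++-identityʳ _) ⟨
  replicate (k ∸ a) c1 ++ (core a b ++ c2 ∷ []) ++ [] ∎)
  where open ≡-Reasoning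

prefix-in-text : ∀ {k} a {b} → a ≤ k → b ≤ k → Occurs (c2 ∷ core a b) (text k)
prefix-in-text {k} a a≤k b≤k =
  occurs-trans (prefix-in-prefixBlock a b≤k)
    (occurs-++ʳ (c1 ∷ []) (occurs-++ˡ (concatMap (suffixBlock k) (upTo (suc k)))
      (occurs-concatMap (prefixBlock k) (∈-upTo⁺ (s≤s a≤k)))))

suffix-in-text : ∀ {k a} b → a ≤ k → b ≤ k → Occurs (core a b ++ c2 ∷ []) (text k)
suffix-in-text {k} b a≤k b≤k =
  occurs-trans (suffix-in-suffixBlock b a≤k)
    (occurs-++ʳ (c1 ∷ concatMap (prefixBlock k) (upTo (suc k)))
      (occurs-concatMap (suffixBlock k) (∈-upTo⁺ (s≤s b≤k))))

runsFrom-core : ∀ c → c ≢ c1 → ∀ a b Y → runsFrom c (core a b ++ Y) ≡ 2 + runsFrom c0 Y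
runsFrom-core c c≢c1 a b Y with c ≟ c1
... | yes c≡c1 = ⊥-elim (c≢c1 c≡c1)
... | no  _    = cong suc (begin
  runsFrom c1 ((replicate a c1 ++ replicate (suc b) c0) ++ Y)
    ≡⟨ cong (runsFrom c1) (++-assoc (replicate a c1) (replicate (suc b) c0) Y) ⟩
  runsFrom c1 (replicate a c1 ++ c0 ∷ replicate b c0 ++ Y)   ≡⟨ runsFrom-replicate _≟_ c1 a _ ⟩
  suc (runsFrom c0 (replicate b c0 ++ Y))                    ≡⟨ cong suc (runsFrom-replicate _≟_ c0 b Y) ⟩
  suc (runsFrom c0 Y)                                        ∎)
  where open ≡-Reasoning

runsFrom-prefixBlock : ∀ k a X → runsFrom c1 (prefixBlock k a ++ X) ≡ 4 + runsFrom c1 X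
runsFrom-prefixBlock k a X =
  cong suc (trans (cong (runsFrom c2) (++-assoc (core a k) (c1 ∷ []) X)) (runsFrom-core c2 (λ ()) a k (c1 ∷ X)))

runsFrom-suffixBlock : ∀ c → c ≢ c0 → ∀ k b X → runsFrom c (suffixBlock k b ++ X) ≡ 4 + runsFrom c2 X
runsFrom-suffixBlock c c≢c0 k b X with c ≟ c0
... | yes c≡c0 = ⊥-elim (c≢c0 c≡c0)
... | no  _    =
  cong suc (trans (cong (runsFrom c0) (++-assoc (core k b) (c2 ∷ []) X)) (runsFrom-core c0 (λ ()) k b (c2 ∷ X)))

runsFrom-prefixBlocks : ∀ k as X →
                        runsFrom c1 (concatMap (prefixBlock k) as ++ X) ≡ length as * 4 + runsFrom c1 X
runsFrom-prefixBlocks k []       X = refl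
runsFrom-prefixBlocks k (a ∷ as) X = begin
  runsFrom c1 ((prefixBlock k a ++ concatMap (prefixBlock k) as) ++ X)
    ≡⟨ cong (runsFrom c1) (++-assoc (prefixBlock k a) (concatMap (prefixBlock k) as) X) ⟩
  runsFrom c1 (prefixBlock k a ++ concatMap (prefixBlock k) as ++ X)
    ≡⟨ runsFrom-prefixBlock k a _ ⟩
  4 + runsFrom c1 (concatMap (prefixBlock k) as ++ X)
    ≡⟨ cong (4 +_) (runsFrom-prefixBlocks k as X) ⟩
  4 + (length as * 4 + runsFrom c1 X)
    ≡⟨ +-assoc 4 (length as * 4) (runsFrom c1 X) ⟨
  length (a ∷ as) * 4 + runsFrom c1 X ∎
  where open ≡-Reasoning

runsFrom-suffixBlocks : ∀ c → c ≢ c0 → ∀ k bs → runsFrom c (concatMap (suffixBlock k) bs) ≡ length bs * 4 + 1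
runsFrom-suffixBlocks c c≢c0 k []       = refl
runsFrom-suffixBlocks c c≢c0 k (b ∷ bs) =
  trans (runsFrom-suffixBlock c c≢c0 k b _)
        (trans (cong (4 +_) (runsFrom-suffixBlocks c2 (λ ()) k bs)) (sym (+-assoc 4 (length bs * 4) 1)))

R-word : ∀ a b → R (word a b) ≡ 4
R-word a b = runsFrom-core c2 (λ ()) a b (c2 ∷ [])

R-text : ∀ k → R (text k) ≡ 8 * suc k + 1
R-text k = begin
  runsFrom c1 (concatMap (prefixBlock k) (upTo (suc k)) ++ concatMap (suffixBlock k) (upTo (suc k)))
    ≡⟨ runsFrom-prefixBlocks k (upTo (suc k)) _ ⟩
  length (upTo (suc k)) * 4 + runsFrom c1 (concatMap (suffixBlock k) (upTo (suc k)))
    ≡⟨ cong (length (upTo (suc k)) * 4 +_) (runsFrom-suffixBlocks c1 (λ ()) k (upTo (suc k))) ⟩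
  length (upTo (suc k)) * 4 + (length (upTo (suc k)) * 4 + 1)
    ≡⟨ cong (λ n → n * 4 + (n * 4 + 1)) (length-upTo (suc k)) ⟩
  suc k * 4 + (suc k * 4 + 1)
    ≡⟨ eight-blocks (suc k) ⟩
  8 * suc k + 1 ∎
  where
  open ≡-Reasoning
  eight-blocks : ∀ n → n * 4 + (n * 4 + 1) ≡ 8 * n + 1
  eight-blocks = solve-∀

no-2-in-core : ∀ a b → All (c2 ≢_) (core a b)
no-2-in-core a b = ++⁺ (replicate⁺ (suc a) (λ ())) (replicate⁺ (suc b) (λ ()))

word-InM4 : ∀ {k a b} → a ≤ k → b ≤ k → InM4 (text k) (word a b)
word-InM4 {k} {a} {b} a≤k b≤k =
  maw-from-ends (text k) c2 (core a b) c2 (word-absent k a b)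
    (prefix-in-text a a≤k b≤k) (suffix-in-text b a≤k b≤k) ,
  ≤-reflexive (sym (R-word a b)) ,
  c2 , core a b , c2 , refl ,
  c1 , replicate a c1 ++ replicate (suc b) c0 , refl ,
  (λ x v u≡xv → All.head (subst (All (c2 ≢_)) u≡xv (no-2-in-core a b))) ,
  (λ y v u≡vy → All.head (++⁻ʳ v (subst (All (c2 ≢_)) u≡vy (no-2-in-core a b))))

word-injective : ∀ {a a′ b b′} → word a b ≡ word a′ b′ → a ≡ a′ × b ≡ b′
word-injective {a} {a′} {b} {b′} eq
  with replicate-++-injective a a′ (λ ()) (∷-injectiveʳ (∷ʳ-injectiveˡ (core a b) (core a′ b′) (∷-injectiveʳ eq)))
... | a≡a′ , zeros≡zeros′ =
  a≡a′ , trans (sym (length-replicate b)) (trans (cong length zeros≡zeros′) (length-replicate b′))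

words : ℕ → List Str
words k = cartesianProductWith word (upTo (suc k)) (upTo (suc k))

words-unique : ∀ k → Unique (words k)
words-unique k = cartesianProductWith⁺ word word-injective (upTo⁺ (suc k)) (upTo⁺ (suc k))

words-InM4 : ∀ k → All (InM4 (text k)) (words k)
words-InM4 k = All.tabulate λ w∈words →
  let a , b , a∈ , b∈ , w≡ = ∈-cartesianProductWith⁻ word (upTo (suc k)) (upTo (suc k)) w∈words
  in subst (InM4 (text k)) (sym w≡) (word-InM4 (s≤s⁻¹ (∈-upTo⁻ a∈)) (s≤s⁻¹ (∈-upTo⁻ b∈)))

length-words : ∀ k → length (words k) ≡ suc k * suc k
length-words k = trans (length-cartesianProductWith word (upTo (suc k)) (upTo (suc k)))
                       (cong₂ _*_ (length-upTo (suc k)) (length-upTo (suc k)))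

R-text-lower : ∀ k → k ≤ R (text k)
R-text-lower k = begin
  k              ≤⟨ n≤1+n k ⟩
  suc k          ≤⟨ m≤n*m (suc k) 8 ⟩
  8 * suc k      ≤⟨ m≤m+n (8 * suc k) 1 ⟩
  8 * suc k + 1  ≡⟨ R-text k ⟨
  R (text k)     ∎
  where open ≤-Reasoning

R-text-upper : ∀ k → R (text k) ≤ 9 * suc k
R-text-upper k = begin
  R (text k)           ≡⟨ R-text k ⟩
  8 * suc k + 1        ≤⟨ +-monoʳ-≤ (8 * suc k) (s≤s z≤n) ⟩
  8 * suc k + suc k    ≡⟨ nine (suc k) ⟩
  9 * suc k            ∎
  where
  open ≤-Reasoning
  nine : ∀ n → 8 * n + n ≡ 9 * n
  nine = solve-∀

R-text-squared-bound : ∀ k → 1 * R (text k) ^ 2 ≤ 81 * length (words k)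
R-text-squared-bound k = begin
  1 * R (text k) ^ 2               ≡⟨ square (R (text k)) ⟩
  R (text k) * R (text k)          ≤⟨ *-mono-≤ (R-text-upper k) (R-text-upper k) ⟩
  (9 * suc k) * (9 * suc k)        ≡⟨ square-9 (suc k) ⟩
  81 * (suc k * suc k)             ≡⟨ cong (81 *_) (length-words k) ⟨
  81 * length (words k)            ∎
  where
  open ≤-Reasoning
  square : ∀ r → 1 * r ^ 2 ≡ r * r
  square r = trans (*-identityˡ (r ^ 2)) (cong (r *_) (*-identityʳ r))
  square-9 : ∀ n → (9 * n) * (9 * n) ≡ 81 * (n * n)
  square-9 = solve-∀

lemma11 : ∃[ p ] ∃[ q ] (0 < p × 0 < q ×
            (∀ (N : ℕ) → ∃[ T ] (N ≤ R T ×
               ∃[ ws ] (Unique ws × All (InM4 T) ws ×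
                        p * (R T ^ 2) ≤ q * length ws))))
lemma11 = 1 , 81 , s≤s z≤n , s≤s z≤n , λ N →
  text N , R-text-lower N , words N , words-unique N , words-InM4 N , R-text-squared-bound N
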